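{- Let $\mathrm{M}$ be a matroid and let $F, G \in \overline{\mathcal{L}}_{\mathrm{M}}$ with $G$ covering $F$, i.e., $F \le G$ and $\operatorname{rk}(G) = \operatorname{rk}(F) + 1$. Then $h_F h_G = h_G^2$ in $A^{\bullet}(\mathrm{M})$.
   Context: A matroid $\mathrm{M}$ is a finite nonempty atomic ranked lattice $\mathcal{L}_{\mathrm{M}}$ (every element is the join of the atoms below it; every maximal chain in $[\emptyset, F]$ has length $\operatorname{rk}(F)$) whose rank function $\operatorname{rk}$ is submodular: $\operatorname{rk}(F_1 \vee F_2) + \operatorname{rk}(F_1 \wedge F_2) \le \operatorname{rk}(F_1) + \operatorname{rk}(F_2)$. Elements are called flats; the minimal element is $\emptyset$, the maximal $E$. Let $\overline{\mathcal{L}}_{\mathrm{M}} = \mathcal{L}_{\mathrm{M}} \setminus \{\emptyset\}$. The augmented Chow ring is $$A^{\bullet}(\mathrm{M}) = \frac{\mathbb{Z}[h_F]_{F \in \overline{\mathcal{L}}_{\mathrm{M}}}}{((h_{F} - h_{G \vee F})(h_G - h_{G \vee F}) : F, G \in \overline{\mathcal{L}}_{\mathrm{M}}) + (h_a^2,\ h_ah_F - h_ah_{F \vee a} : F \in \overline{\mathcal{L}}_{\mathrm{M}},\ a \text{ an atom})},$$ graded with each $h_F$ in degree $1$. -}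

module Defs where

open import Data.Nat using (ℕ; zero; suc; _+_; _≤_)
open import Data.Product using (_×_; _,_; proj₁)
open import Data.Sum using (_⊎_)
open import Data.List using (List)
open import Data.List.Membership.Propositional using (_∈_)
open import Relation.Binary.PropositionalEquality using (_≡_; _≢_; refl; sym; subst)
open import Relation.Nullary using (¬_)

Covers : {A : Set} → (A → A → Set) → A → A → Set
Covers {A} _≤′_ x y = (x ≤′ y) × (x ≢ y) × (∀ z → x ≤′ z → z ≤′ y → (z ≡ x) ⊎ (z ≡ y))

data MaxChain {A : Set} (_≤′_ : A → A → Set) : A → A → ℕ → Set where
  nil  : ∀ {x} → MaxChain _≤′_ x x zero
  cons : ∀ {x y z k} → Covers _≤′_ x y → MaxChain _≤′_ y z k → MaxChain _≤′_ x z (suc k)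

-- A matroid as a finite, atomic, ranked lattice with submodular rank function.
record Matroid : Set₁ where
  field
    Carrier   : Set                               -- the flats
    _≤ₗ_      : Carrier → Carrier → Set
    ≤ₗ-refl   : ∀ {x} → x ≤ₗ x
    ≤ₗ-trans  : ∀ {x y z} → x ≤ₗ y → y ≤ₗ z → x ≤ₗ z
    ≤ₗ-antisym : ∀ {x y} → x ≤ₗ y → y ≤ₗ x → x ≡ y
    _∨_       : Carrier → Carrier → Carrier
    _∧_       : Carrier → Carrier → Carrier
    x≤x∨y     : ∀ x y → x ≤ₗ (x ∨ y)
    y≤x∨y     : ∀ x y → y ≤ₗ (x ∨ y)
    ∨-least   : ∀ {x y z} → x ≤ₗ z → y ≤ₗ z → (x ∨ y) ≤ₗ z
    x∧y≤x     : ∀ x y → (x ∧ y) ≤ₗ x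
    x∧y≤y     : ∀ x y → (x ∧ y) ≤ₗ y
    ∧-greatest : ∀ {x y z} → z ≤ₗ x → z ≤ₗ y → z ≤ₗ (x ∧ y)
    ∅         : Carrier
    ∅-min     : ∀ x → ∅ ≤ₗ x
    E         : Carrier
    E-max     : ∀ x → x ≤ₗ E
    elems     : List Carrier
    elems-complete : ∀ x → x ∈ elems
    -- atomic: every flat is the join (least upper bound) of the atoms below it
    atomic    : ∀ F U → (∀ a → Covers _≤ₗ_ ∅ a → a ≤ₗ F → a ≤ₗ U) → F ≤ₗ U
    rk        : Carrier → ℕ
    ranked    : ∀ F k → MaxChain _≤ₗ_ ∅ F k → k ≡ rk F
    submod    : ∀ F G → rk (F ∨ G) + rk (F ∧ G) ≤ rk F + rk G

  Atom : Carrier → Set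
  Atom a = Covers _≤ₗ_ ∅ a

  ∨-nonempty : ∀ {F} G → F ≢ ∅ → (G ∨ F) ≢ ∅
  ∨-nonempty {F} G F≢∅ eq = F≢∅ (≤ₗ-antisym (subst (F ≤ₗ_) eq (y≤x∨y G F)) (∅-min F))

  ∨-nonemptyˡ : ∀ {F} G → F ≢ ∅ → (F ∨ G) ≢ ∅
  ∨-nonemptyˡ {F} G F≢∅ eq = F≢∅ (≤ₗ-antisym (subst (F ≤ₗ_) eq (x≤x∨y F G)) (∅-min F))

  atom-nonempty : ∀ {a} → Atom a → a ≢ ∅
  atom-nonempty (_ , ∅≢a , _) a≡∅ = ∅≢a (sym a≡∅)

-- Polynomial expressions in the variables h_F (F ∈ L̄_M) with integer coefficients
-- (free commutative ring on the variables). The proof argument is irrelevant,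
-- so h_F depends only on F.
module AugmentedChow (M : Matroid) where
  open Matroid M

  infixl 6 _+ₑ_ _-ₑ_
  infixl 7 _*ₑ_
  infix 4 _≈_

  data Expr : Set where
    h    : (F : Carrier) → .(F ≢ ∅) → Expr
    0ₑ   : Expr
    1ₑ   : Expr
    _+ₑ_ : Expr → Expr → Expr
    _*ₑ_ : Expr → Expr → Expr
    -ₑ_  : Expr → Expr

  _-ₑ_ : Expr → Expr → Expr
  x -ₑ y = x +ₑ (-ₑ y)

  -- Equality in A•(M) = ℤ[h_F] / I : the least congruence containing the
  -- commutative ring axioms and identifying every generator of I with 0.
  data _≈_ : Expr → Expr → Set where
    ≈-refl  : ∀ {x} → x ≈ x
    ≈-sym   : ∀ {x y} → x ≈ y → y ≈ x
    ≈-trans : ∀ {x y z} → x ≈ y → y ≈ z → x ≈ z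
    +-cong  : ∀ {x x′ y y′} → x ≈ x′ → y ≈ y′ → x +ₑ y ≈ x′ +ₑ y′
    *-cong  : ∀ {x x′ y y′} → x ≈ x′ → y ≈ y′ → x *ₑ y ≈ x′ *ₑ y′
    neg-cong : ∀ {x x′} → x ≈ x′ → -ₑ x ≈ -ₑ x′
    +-assoc : ∀ x y z → (x +ₑ y) +ₑ z ≈ x +ₑ (y +ₑ z)
    +-comm  : ∀ x y → x +ₑ y ≈ y +ₑ x
    +-idˡ   : ∀ x → 0ₑ +ₑ x ≈ x
    +-invˡ  : ∀ x → (-ₑ x) +ₑ x ≈ 0ₑ
    *-assoc : ∀ x y z → (x *ₑ y) *ₑ z ≈ x *ₑ (y *ₑ z)
    *-comm  : ∀ x y → x *ₑ y ≈ y *ₑ x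
    *-idˡ   : ∀ x → 1ₑ *ₑ x ≈ x
    distribˡ : ∀ x y z → x *ₑ (y +ₑ z) ≈ (x *ₑ y) +ₑ (x *ₑ z)
    rel-FG  : ∀ F G (p : F ≢ ∅) (q : G ≢ ∅) →
              (h F p -ₑ h (G ∨ F) (∨-nonempty G p)) *ₑ (h G q -ₑ h (G ∨ F) (∨-nonempty G p)) ≈ 0ₑ
    rel-aa  : ∀ a (α : Atom a) → h a (atom-nonempty α) *ₑ h a (atom-nonempty α) ≈ 0ₑ
    rel-aF  : ∀ a (α : Atom a) F (p : F ≢ ∅) →
              h a (atom-nonempty α) *ₑ h F p -ₑ h a (atom-nonempty α) *ₑ h (F ∨ a) (∨-nonemptyˡ a p) ≈ 0ₑ

-- Strict monotonicity of the rank (maximal chains exist in a finite lattice, and all have length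
-- rk) turns rk G = rk F + 1 into F ⋖ G.  Atomicity yields an atom a ≤ G with a ≰ F, so
-- F < F ∨ a ≤ G forces F ∨ a = G.  The relations for the pair (F, a) and for the atom a then
-- read (h_F − h_G)(h_a − h_G) = 0 and h_a (h_F − h_G) = 0, whence (h_F − h_G) h_G = 0.
module Submission where

open import Defs
open import Data.Nat using (ℕ; _+_)
open import Relation.Binary.PropositionalEquality using (_≡_; _≢_)

open import Level using (Level; 0ℓ)
open import Algebra.Bundles using (CommutativeRing)
open import Algebra.Structures using (IsCommutativeRing)
import Data.Nat as ℕ
import Data.Nat.Properties as ℕ
open import Data.Fin using (Fin)
import Data.Fin.Properties as Fin
open import Data.List using (List; []; _∷_; length; lookup)
open import Data.List.Membership.Propositional using (_∈_; lose)
open import Data.List.Relation.Unary.Any as Any using (index)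
open import Data.List.Relation.Unary.Any.Properties using (lookup-index)
import Data.List.Relation.Unary.All as All
open import Data.Product using (∃; _×_; _,_; proj₁; proj₂)
open import Data.Sum using (_⊎_; inj₁; inj₂)
open import Function using (_∘_)
open import Relation.Nullary using (¬_; Dec; yes; no; contradiction)
open import Relation.Nullary.Decidable using (map′; _×-dec_; _⊎-dec_; _→-dec_; ¬?; decidable-stable)
open import Relation.Unary using (Pred; Decidable)
open import Relation.Binary using (IsPartialOrder; IsEquivalence; Setoid; DecidableEquality)
open import Relation.Binary.Lattice using (JoinSemilattice)
open import Relation.Binary.PropositionalEquality as ≡ using (refl; cong; subst; subst₂)

module FiniteEnumeration {a : Level} {A : Set a} {xs : List A} (complete : ∀ x → x ∈ xs) where

  position : A → Fin (length xs)
  position x = index (complete x)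

  _≟_ : DecidableEquality A
  x ≟ y = map′ position-injective (cong position) (position x Fin.≟ position y)
    where
    position-injective : position x ≡ position y → x ≡ y
    position-injective eq = ≡.trans (lookup-index (complete x))
                                    (≡.trans (cong (lookup xs) eq) (≡.sym (lookup-index (complete y))))

  all? : ∀ {p} {P : Pred A p} → Decidable P → Dec (∀ x → P x)
  all? P? = map′ (λ all x → All.lookup all (complete x)) (λ ∀P → All.tabulate (λ _ → ∀P _))
                 (All.all? P? xs)

  any? : ∀ {p} {P : Pred A p} → Decidable P → Dec (∃ P)
  any? P? = map′ Any.satisfied (λ (x , px) → lose (complete x) px) (Any.any? P? xs)

module _ {c ℓ : Level} (R : CommutativeRing c ℓ) where
  open CommutativeRing R
  open import Algebra.Properties.Group +-group using (x∙y⁻¹≈ε⇒x≈y)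
  open import Algebra.Properties.Ring ring using (x[y-z]≈xy-xz; [y-z]x≈yx-zx)
  open import Relation.Binary.Reasoning.Setoid setoid

  [x-y][z-y]≈0∧zx-zy≈0⇒xy≈yy : ∀ {x y z} → (x - y) * (z - y) ≈ 0# → z * x - z * y ≈ 0# →
                               x * y ≈ y * y
  [x-y][z-y]≈0∧zx-zy≈0⇒xy≈yy {x} {y} {z} r₁ r₂ = x∙y⁻¹≈ε⇒x≈y (x * y) (y * y) (begin
    x * y - y * y ≈⟨ [y-z]x≈yx-zx y x y ⟨
    (x - y) * y   ≈⟨ [x-y]y≈0 ⟩
    0#            ∎)
    where
    [x-y]z≈0 : (x - y) * z ≈ 0#
    [x-y]z≈0 = trans (*-comm (x - y) z) (trans (x[y-z]≈xy-xz z x y) r₂)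

    [x-y]y≈0 : (x - y) * y ≈ 0#
    [x-y]y≈0 = sym (x∙y⁻¹≈ε⇒x≈y 0# ((x - y) * y) (begin
      0# - (x - y) * y          ≈⟨ +-congʳ [x-y]z≈0 ⟨
      (x - y) * z - (x - y) * y ≈⟨ x[y-z]≈xy-xz (x - y) z y ⟨
      (x - y) * (z - y)         ≈⟨ r₁ ⟩
      0#                        ∎))

module MatroidLattice (M : Matroid) where
  open Matroid M

  isPartialOrder : IsPartialOrder _≡_ _≤ₗ_
  isPartialOrder = record
    { isPreorder = record
      { isEquivalence = ≡.isEquivalence
      ; reflexive = λ { refl → ≤ₗ-refl }
      ; trans = ≤ₗ-trans
      }
    ; antisym = ≤ₗ-antisym
    }

  joinSemilattice : JoinSemilattice 0ℓ 0ℓ 0ℓ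
  joinSemilattice = record
    { isJoinSemilattice = record
      { isPartialOrder = isPartialOrder
      ; supremum = λ x y → x≤x∨y x y , y≤x∨y x y , λ _ → ∨-least
      }
    }

  open import Relation.Binary.Lattice.Properties.JoinSemilattice joinSemilattice using (∨-comm; x≤y⇒x∨y≈y)
  open import Relation.Binary.Properties.Poset (JoinSemilattice.poset joinSemilattice)
    using (_<_; <-trans; <⇒≱)
  open FiniteEnumeration elems-complete using (_≟_; all?; any?)

  _≤?_ : ∀ x y → Dec (x ≤ₗ y)
  x ≤? y = map′ (λ x∨y≡y → subst (x ≤ₗ_) x∨y≡y (x≤x∨y x y)) x≤y⇒x∨y≈y ((x ∨ y) ≟ y)

  _<?_ : ∀ x y → Dec (x < y)
  x <? y = (x ≤? y) ×-dec ¬? (x ≟ y)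

  covers? : ∀ x y → Dec (Covers _≤ₗ_ x y)
  covers? x y = (x ≤? y) ×-dec ¬? (x ≟ y) ×-dec
    all? (λ z → (x ≤? z) →-dec ((z ≤? y) →-dec ((z ≟ x) ⊎-dec (z ≟ y))))

  _++ᶜ_ : ∀ {x y z k l} → MaxChain _≤ₗ_ x y k → MaxChain _≤ₗ_ y z l → MaxChain _≤ₗ_ x z (k + l)
  nil         ++ᶜ d = d
  cons x⋖y c  ++ᶜ d = cons x⋖y (c ++ᶜ d)

  -- Recursion on a list containing every flat strictly between x and y: a flat w of the list
  -- lying strictly between them splits [x, y] into two intervals whose interiors avoid w.
  maxChain-within : ∀ ws {x y} → x ≤ₗ y → (∀ {z} → x < z → z < y → z ∈ ws) → ∃ (MaxChain _≤ₗ_ x y)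
  maxChain-within [] {x} {y} x≤y interior with x ≟ y
  ... | yes refl = 0 , nil
  ... | no x≢y = 1 , cons (x≤y , x≢y , nothing-between) nil
    where
    nothing-between : ∀ z → x ≤ₗ z → z ≤ₗ y → z ≡ x ⊎ z ≡ y
    nothing-between z x≤z z≤y with z ≟ x | z ≟ y
    ... | yes z≡x | _       = inj₁ z≡x
    ... | no _    | yes z≡y = inj₂ z≡y
    ... | no z≢x  | no z≢y  = contradiction (interior (x≤z , z≢x ∘ ≡.sym) (z≤y , z≢y)) λ ()
  maxChain-within (w ∷ ws) {x} {y} x≤y interior with (x <? w) ×-dec (w <? y)
  ... | yes (x<w , w<y) =
    let k , c = maxChain-within ws (proj₁ x<w) λ x<z z<w →
                  Any.tail (proj₂ z<w) (interior x<z (<-trans z<w w<y))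
        l , d = maxChain-within ws (proj₁ w<y) λ w<z z<y →
                  Any.tail (proj₂ w<z ∘ ≡.sym) (interior (<-trans x<w w<z) z<y)
    in k + l , c ++ᶜ d
  ... | no ¬x<w<y = maxChain-within ws x≤y λ x<z z<y →
                      Any.tail (λ { refl → ¬x<w<y (x<z , z<y) }) (interior x<z z<y)

  maxChain : ∀ {x y} → x ≤ₗ y → ∃ (MaxChain _≤ₗ_ x y)
  maxChain x≤y = maxChain-within elems x≤y λ _ _ → elems-complete _

  rk-mono-< : ∀ {x y} → x < y → rk x ℕ.< rk y
  rk-mono-< {x} {y} (x≤y , x≢y) with maxChain (∅-min x) | maxChain x≤y
  ... | _ , _ | ℕ.zero , nil = contradiction refl x≢y
  ... | k , c | ℕ.suc l , d =
    subst₂ ℕ._<_ (ranked x k c) (ranked y (k + ℕ.suc l) (c ++ᶜ d)) (ℕ.m<m+n k ℕ.z<s)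

  rk≡1+rk⇒⋖ : ∀ {F G} → F ≤ₗ G → rk G ≡ ℕ.suc (rk F) → Covers _≤ₗ_ F G
  rk≡1+rk⇒⋖ {F} {G} F≤G rkG = F≤G , F≢G , nothing-between
    where
    F≢G : F ≢ G
    F≢G refl = ℕ.1+n≰n (ℕ.≤-reflexive (≡.sym rkG))

    nothing-between : ∀ z → F ≤ₗ z → z ≤ₗ G → z ≡ F ⊎ z ≡ G
    nothing-between z F≤z z≤G with z ≟ F | z ≟ G
    ... | yes z≡F | _       = inj₁ z≡F
    ... | no _    | yes z≡G = inj₂ z≡G
    ... | no z≢F  | no z≢G  =
      contradiction (ℕ.m<1+n⇒m≤n (subst (rk z ℕ.<_) rkG (rk-mono-< (z≤G , z≢G))))
                    (ℕ.<⇒≱ (rk-mono-< (F≤z , z≢F ∘ ≡.sym)))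

  ∃-atom-≤-≰ : ∀ {F G} → ¬ G ≤ₗ F → ∃ λ a → Atom a × a ≤ₗ G × ¬ a ≤ₗ F
  ∃-atom-≤-≰ {F} {G} G≰F with any? (λ a → covers? ∅ a ×-dec (a ≤? G) ×-dec ¬? (a ≤? F))
  ... | yes found = found
  ... | no none = contradiction (atomic G F atoms-of-G-below-F) G≰F
    where
    atoms-of-G-below-F : ∀ a → Atom a → a ≤ₗ G → a ≤ₗ F
    atoms-of-G-below-F a α a≤G = decidable-stable (a ≤? F) λ a≰F → none (a , α , a≤G , a≰F)

  ⋖⇒∃-atom-∨≡ : ∀ {F G} → Covers _≤ₗ_ F G → ∃ λ a → Atom a × F ∨ a ≡ G
  ⋖⇒∃-atom-∨≡ {F} {G} (F≤G , F≢G , between) with ∃-atom-≤-≰ (<⇒≱ (F≤G , F≢G))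
  ... | a , α , a≤G , a≰F with between (F ∨ a) (x≤x∨y F a) (∨-least F≤G a≤G)
  ...   | inj₁ F∨a≡F = contradiction (subst (a ≤ₗ_) F∨a≡F (y≤x∨y F a)) a≰F
  ...   | inj₂ F∨a≡G = a , α , F∨a≡G

module ChowRing (M : Matroid) where
  open Matroid M
  open AugmentedChow M
  open import Relation.Binary.Lattice.Properties.JoinSemilattice (MatroidLattice.joinSemilattice M)
    using (∨-comm)

  ≈-isEquivalence : IsEquivalence _≈_
  ≈-isEquivalence = record { refl = ≈-refl ; sym = ≈-sym ; trans = ≈-trans }

  ≈-setoid : Setoid 0ℓ 0ℓ
  ≈-setoid = record { isEquivalence = ≈-isEquivalence }

  open import Algebra.Consequences.Setoid ≈-setoid using (comm∧idˡ⇒id; comm∧invˡ⇒inv; comm∧distrˡ⇒distr)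

  isCommutativeRing : IsCommutativeRing _≈_ _+ₑ_ _*ₑ_ -ₑ_ 0ₑ 1ₑ
  isCommutativeRing = record
    { isRing = record
      { +-isAbelianGroup = record
        { isGroup = record
          { isMonoid = record
            { isSemigroup = record
              { isMagma = record { isEquivalence = ≈-isEquivalence ; ∙-cong = +-cong }
              ; assoc = +-assoc
              }
            ; identity = comm∧idˡ⇒id +-comm +-idˡ
            }
          ; inverse = comm∧invˡ⇒inv +-comm +-invˡ
          ; ⁻¹-cong = neg-cong
          }
        ; comm = +-comm
        }
      ; *-cong = *-cong
      ; *-assoc = *-assoc
      ; *-identity = comm∧idˡ⇒id *-comm *-idˡ
      ; distrib = comm∧distrˡ⇒distr +-cong *-comm distribˡ
      }
    ; *-comm = *-comm
    }

  commutativeRing : CommutativeRing 0ℓ 0ℓ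
  commutativeRing = record { isCommutativeRing = isCommutativeRing }

  h-≡ : ∀ {F G} → F ≡ G → .(p : F ≢ ∅) .(q : G ≢ ∅) → h F p ≡ h G q
  h-≡ refl _ _ = refl

  F∨a≡G⇒hF*hG≈hG*hG : ∀ {F G a} (p : F ≢ ∅) (q : G ≢ ∅) (α : Atom a) → F ∨ a ≡ G →
                       h F p *ₑ h G q ≈ h G q *ₑ h G q
  F∨a≡G⇒hF*hG≈hG*hG {F} {a = a} p q α refl =
    [x-y][z-y]≈0∧zx-zy≈0⇒xy≈yy commutativeRing
      (subst (λ h-F∨a → (h F p -ₑ h-F∨a) *ₑ (hₐ -ₑ h-F∨a) ≈ 0ₑ) (h-≡ (∨-comm a F) _ q)
             (rel-FG F a p a≢∅))
      (rel-aF a α F p)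
    where
    a≢∅ : a ≢ ∅
    a≢∅ = atom-nonempty α

    hₐ : Expr
    hₐ = h a a≢∅

open Matroid
open AugmentedChow

lemma2p3 : (M : Matroid) (F G : Carrier M) (p : F ≢ ∅ M) (q : G ≢ ∅ M) →
    _≤ₗ_ M F G → rk M G ≡ rk M F + 1 →
    _≈_ M (h F p *ₑ h G q) (h G q *ₑ h G q)
lemma2p3 M F G p q F≤G rkG =
  let a , α , F∨a≡G = ⋖⇒∃-atom-∨≡ (rk≡1+rk⇒⋖ F≤G rkG≡1+rkF)
  in F∨a≡G⇒hF*hG≈hG*hG p q α F∨a≡G
  where
  open MatroidLattice M
  open ChowRing M

  rkG≡1+rkF : rk M G ≡ ℕ.suc (rk M F)
  rkG≡1+rkF = ≡.trans rkG (ℕ.+-comm (rk M F) 1)
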